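{- Let $K_{m,n}$ with $m,n>2$ be a subgraph of $\mathcal{G}_\infty$, with partite sets $X$ and $Y$ (so every vertex of $X$ is adjacent in $\mathcal{G}_\infty$ to every vertex of $Y$). Then either $X\subseteq 6\mathbb{N}_0$ and $Y\cap 6\mathbb{N}_0=\emptyset$, or $Y\subseteq 6\mathbb{N}_0$ and $X\cap 6\mathbb{N}_0=\emptyset$.
   Context: Let $\mathcal{P}$ be the set of odd primes and $\mathbb{N}_0=\{0,1,2,\dots\}$, so $6\mathbb{N}_0=\{0,6,12,\dots\}$. $\mathcal{G}_\infty$ is the simple undirected graph whose vertex set is the set of non-negative even integers, in which distinct $a,b$ are adjacent iff $\frac{a+b}{2}\in\mathcal{P}$ and $\frac{|a-b|}{2}\in\mathcal{P}$. -}

module Defs where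

open import Data.Nat.Base using (ℕ; _+_; _/_; ∣_-_∣)
open import Data.Nat.Divisibility using (_∣_)
open import Data.Nat.Primality using (Prime)
open import Data.Product using (_×_)
open import Relation.Binary.PropositionalEquality using (_≡_)
open import Relation.Nullary using (¬_)

IsVertex : ℕ → Set
IsVertex a = 2 ∣ a

OddPrime : ℕ → Set
OddPrime p = Prime p × ¬ (p ≡ 2)

Adj : ℕ → ℕ → Set
Adj a b = ¬ (a ≡ b) × OddPrime ((a + b) / 2) × OddPrime (∣ a - b ∣ / 2)

In6N : ℕ → Set
In6N a = 6 ∣ a

-- Write the vertices as a = 2q, b = 2r: adjacency says that q + r and |q - r| are odd primes,
-- and 6 ∣ a iff 3 ∣ q. If 3 divides both q and r it divides both primes, so {a, b} = {0, 6}; if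
-- it divides neither, it divides q + r or q - r, so a + b = 6 or |a - b| = 6. Hence a vertex w
-- outside 6ℕ₀ has at most two neighbours outside 6ℕ₀: only w ± 6 are at distance 6, and two of
-- them at distance 6 force w ≥ 6, so that a third neighbour with sum 6 would be 0.
-- If X meets 6ℕ₀ and Y does too, the two meet in an edge {0, 6}; then two further vertices of X
-- and two of Y lie outside 6ℕ₀ and, since the neighbours of 0 other than 6 exceed 6, are pairwise
-- at distance 6, which no four such points can be. So Y avoids 6ℕ₀, and by the bound on
-- neighbours X lies inside it; if X misses 6ℕ₀, the same bound puts Y inside.
module Submission where

open import Defs
open import Data.Nat.Base using (ℕ; zero; suc; _+_; _*_; _/_; ∣_-_∣; _<_; _≤_; z≤n; s≤s)
open import Data.Nat.Properties
open import Data.Nat.Divisibility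
  using (_∣_; divides; _∣?_; ∣m∣n⇒∣m+n; _∣0; ∣-refl; *-cancelʳ-∣; *-monoˡ-∣)
open import Data.Nat.DivMod using (m*n/n≡m; _divMod_; result)
open import Data.Nat.Primality using (Prime; prime⇒irreducible; ¬prime[0]; ¬prime[1])
open import Data.Nat.Tactic.RingSolver using (solve-∀)
open import Data.Fin.Base using (zero; suc)
open import Data.List.Base using (List; length; []; _∷_)
open import Data.List.Membership.Propositional using (_∈_; find; lose)
open import Data.List.Relation.Unary.Any using (here; there; any?)
open import Data.List.Relation.Unary.All using (_∷_)
open import Data.List.Relation.Unary.AllPairs using (_∷_)
open import Data.List.Relation.Unary.Unique.Propositional using (Unique)
open import Data.Product using (_×_; _,_; proj₁; proj₂)
import Data.Product as Product
open import Data.Sum using (_⊎_; inj₁; inj₂; [_,_]′)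
import Data.Sum as Sum
open import Data.Empty using (⊥)
open import Function using (_∘_)
open import Relation.Nullary using (¬_; yes; no; contradiction)
open import Relation.Nullary.Decidable using (decidable-stable)
open import Relation.Binary.Definitions using (DecidableEquality)
open import Relation.Binary.PropositionalEquality
  using (_≡_; _≢_; refl; sym; trans; cong; subst)

private
  variable
    a b c d k m n p w x y x₁ x₂ y₁ y₂ : ℕ
    X Y : List ℕ

∣m∣n⇒∣∣m-n∣ : d ∣ m → d ∣ n → d ∣ ∣ m - n ∣
∣m∣n⇒∣∣m-n∣ {d} (divides s refl) (divides t refl) = divides ∣ s - t ∣ (sym (*-distribʳ-∣-∣ d s t))

3∣m*3 : ∀ m → 3 ∣ m * 3
3∣m*3 m = divides m refl

[1+m*3]+[2+n*3]≡[1+m+n]*3 : ∀ m n → (1 + m * 3) + (2 + n * 3) ≡ (1 + m + n) * 3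
[1+m*3]+[2+n*3]≡[1+m+n]*3 = solve-∀

[2+m*3]+[1+n*3]≡[1+m+n]*3 : ∀ m n → (2 + m * 3) + (1 + n * 3) ≡ (1 + m + n) * 3
[2+m*3]+[1+n*3]≡[1+m+n]*3 = solve-∀

3∤m⇒3∤n⇒3∣m+n⊎3∣∣m-n∣ : ∀ m n → ¬ 3 ∣ m → ¬ 3 ∣ n → 3 ∣ m + n ⊎ 3 ∣ ∣ m - n ∣
3∤m⇒3∤n⇒3∣m+n⊎3∣∣m-n∣ m n 3∤m 3∤n with m divMod 3 | n divMod 3
... | result s zero refl             | _                              = contradiction (3∣m*3 s) 3∤m
... | _                              | result t zero refl             = contradiction (3∣m*3 t) 3∤n
... | result s (suc zero) refl       | result t (suc zero) refl       =
  inj₂ (∣m∣n⇒∣∣m-n∣ (3∣m*3 s) (3∣m*3 t))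
... | result s (suc (suc zero)) refl | result t (suc (suc zero)) refl =
  inj₂ (∣m∣n⇒∣∣m-n∣ (3∣m*3 s) (3∣m*3 t))
... | result s (suc zero) refl       | result t (suc (suc zero)) refl =
  inj₁ (divides (1 + s + t) ([1+m*3]+[2+n*3]≡[1+m+n]*3 s t))
... | result s (suc (suc zero)) refl | result t (suc zero) refl       =
  inj₁ (divides (1 + s + t) ([2+m*3]+[1+n*3]≡[1+m+n]*3 s t))

prime∧3∣⇒≡3 : Prime p → 3 ∣ p → p ≡ 3
prime∧3∣⇒≡3 pr 3∣p = [ (λ ()) , sym ]′ (prime⇒irreducible pr 3∣p)

oddPrime⇒3≤ : OddPrime p → 3 ≤ p
oddPrime⇒3≤ {0}                 (pr , _)  = contradiction pr ¬prime[0]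
oddPrime⇒3≤ {1}                 (pr , _)  = contradiction pr ¬prime[1]
oddPrime⇒3≤ {2}                 (_ , p≢2) = contradiction refl p≢2
oddPrime⇒3≤ {suc (suc (suc p))} _         = s≤s (s≤s (s≤s z≤n))

sum≡dist⇒0 : ∀ m n → m + n ≡ ∣ m - n ∣ → m ≡ 0 ⊎ n ≡ 0
sum≡dist⇒0 zero    n       _ = inj₁ refl
sum≡dist⇒0 (suc m) zero    _ = inj₂ refl
sum≡dist⇒0 (suc m) (suc n) e = contradiction (subst (∣ m - n ∣ <_) e ∣m-n∣<) (<-irrefl refl)
  where
  ∣m-n∣< : ∣ m - n ∣ < suc m + suc n
  ∣m-n∣< = s≤s (≤-trans (∣m-n∣≤m⊔n m n) (≤-trans (m⊔n≤m+n m n) (+-monoʳ-≤ m (n≤1+n n))))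

sum∧dist≡k⇒endpoints : m + n ≡ k → ∣ m - n ∣ ≡ k → (m ≡ 0 × n ≡ k) ⊎ (m ≡ k × n ≡ 0)
sum∧dist≡k⇒endpoints {m} {n} sum dist with sum≡dist⇒0 m n (trans sum (sym dist))
... | inj₁ refl = inj₁ (refl , sum)
... | inj₂ refl = inj₂ (trans (sym (+-identityʳ m)) sum , refl)

∣m-n∣≡k⇒n≡m+k⊎m≡n+k : ∀ m n → ∣ m - n ∣ ≡ k → n ≡ m + k ⊎ m ≡ n + k
∣m-n∣≡k⇒n≡m+k⊎m≡n+k zero    n       e = inj₁ e
∣m-n∣≡k⇒n≡m+k⊎m≡n+k (suc m) zero    e = inj₂ e
∣m-n∣≡k⇒n≡m+k⊎m≡n+k (suc m) (suc n) e = Sum.map (cong suc) (cong suc) (∣m-n∣≡k⇒n≡m+k⊎m≡n+k m n e)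

[m+k+k]+m≡[m+k]+[m+k] : ∀ m k → (m + k + k) + m ≡ (m + k) + (m + k)
[m+k+k]+m≡[m+k]+[m+k] = solve-∀

-- a and b can only be x - k and x + k.
equidistant⇒sum≡double : ∀ {x a b k} → ∣ x - a ∣ ≡ k → ∣ x - b ∣ ≡ k → a ≢ b → a + b ≡ x + x
equidistant⇒sum≡double {x} {a} {b} {k} ea eb a≢b
  with ∣m-n∣≡k⇒n≡m+k⊎m≡n+k x a ea | ∣m-n∣≡k⇒n≡m+k⊎m≡n+k x b eb
... | inj₁ refl | inj₁ refl = contradiction refl a≢b
... | inj₂ e₁   | inj₂ e₂   = contradiction (+-cancelʳ-≡ k a b (trans (sym e₁) e₂)) a≢b
... | inj₁ refl | inj₂ refl = [m+k+k]+m≡[m+k]+[m+k] b k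
... | inj₂ refl | inj₁ refl = trans (+-comm a _) ([m+k+k]+m≡[m+k]+[m+k] a k)

equidistant⇒k≤ : ∀ {x a b k} → ∣ x - a ∣ ≡ k → ∣ x - b ∣ ≡ k → a ≢ b → k ≤ x
equidistant⇒k≤ {x} {a} {b} {k} ea eb a≢b
  with ∣m-n∣≡k⇒n≡m+k⊎m≡n+k x a ea | ∣m-n∣≡k⇒n≡m+k⊎m≡n+k x b eb
... | inj₁ refl | inj₁ refl = contradiction refl a≢b
... | inj₂ refl | _         = m≤n+m k a
... | inj₁ _    | inj₂ refl = m≤n+m k b

m+m≡n+n⇒m≡n : ∀ m n → m + m ≡ n + n → m ≡ n
m+m≡n+n⇒m≡n zero    zero    _ = refl
m+m≡n+n⇒m≡n (suc m) (suc n) e =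
  cong suc (m+m≡n+n⇒m≡n m n (suc-injective (trans (sym (+-suc m m)) (trans (suc-injective e) (+-suc n n)))))

¬equidistant-square : x₁ ≢ x₂ → y₁ ≢ y₂ →
  ∣ x₁ - y₁ ∣ ≡ k → ∣ x₁ - y₂ ∣ ≡ k → ∣ x₂ - y₁ ∣ ≡ k → ∣ x₂ - y₂ ∣ ≡ k → ⊥
¬equidistant-square {x₁} {x₂} {y₁} {y₂} x₁≢x₂ y₁≢y₂ e₁₁ e₁₂ e₂₁ e₂₂ =
  x₁≢x₂ (m+m≡n+n⇒m≡n x₁ x₂ (trans (sym (equidistant⇒sum≡double {x₁} e₁₁ e₁₂ y₁≢y₂))
                                   (equidistant⇒sum≡double {x₂} e₂₁ e₂₂ y₁≢y₂)))

Near : ℕ → ℕ → ℕ → Set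
Near k a b = a + b ≡ k ⊎ ∣ a - b ∣ ≡ k

near-*2 : ∀ {k} q r → Near k q r → Near (k * 2) (q * 2) (r * 2)
near-*2 q r = Sum.map (trans (sym (*-distribʳ-+ 2 q r)) ∘ cong (_* 2))
                      (trans (sym (*-distribʳ-∣-∣ 2 q r)) ∘ cong (_* 2))

k<n∧near⇒dist : k < n → Near k m n → ∣ m - n ∣ ≡ k
k<n∧near⇒dist {n = n} {m} k<n (inj₁ sum) = contradiction (subst (n ≤_) sum (m≤n+m n m)) (<⇒≱ k<n)
k<n∧near⇒dist         k<n (inj₂ dist) = dist

sum∧equidistant⇒0 : ∀ {w c a b k} → w + c ≡ k → ∣ w - a ∣ ≡ k → ∣ w - b ∣ ≡ k → a ≢ b → c ≡ 0
sum∧equidistant⇒0 {w} {c} {k = k} sum ea eb a≢b = n≤0⇒n≡0 (+-cancelˡ-≤ w c 0 w+c≤w+0)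
  where
  open ≤-Reasoning
  w+c≤w+0 : w + c ≤ w + 0
  w+c≤w+0 = begin
    w + c ≡⟨ sum ⟩
    k     ≤⟨ equidistant⇒k≤ {w} ea eb a≢b ⟩
    w     ≡⟨ +-identityʳ w ⟨
    w + 0 ∎

¬three-near : a ≢ b → a ≢ c → b ≢ c → a ≢ 0 → b ≢ 0 → c ≢ 0 →
  Near k w a → Near k w b → Near k w c → ⊥
¬three-near {w = w} a≢b _ _ _ _ _ (inj₁ sa) (inj₁ sb) _ = a≢b (+-cancelˡ-≡ w _ _ (trans sa (sym sb)))
¬three-near {w = w} _ a≢c _ _ _ _ (inj₁ sa) _ (inj₁ sc) = a≢c (+-cancelˡ-≡ w _ _ (trans sa (sym sc)))
¬three-near {w = w} _ _ b≢c _ _ _ _ (inj₁ sb) (inj₁ sc) = b≢c (+-cancelˡ-≡ w _ _ (trans sb (sym sc)))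
¬three-near {w = w} _ _ b≢c a≢0 _ _ (inj₁ sa) (inj₂ db) (inj₂ dc) = a≢0 (sum∧equidistant⇒0 {w} sa db dc b≢c)
¬three-near {w = w} _ a≢c _ _ b≢0 _ (inj₂ da) (inj₁ sb) (inj₂ dc) = b≢0 (sum∧equidistant⇒0 {w} sb da dc a≢c)
¬three-near {w = w} a≢b _ _ _ _ c≢0 (inj₂ da) (inj₂ db) (inj₁ sc) = c≢0 (sum∧equidistant⇒0 {w} sc da db a≢b)
¬three-near {w = w} a≢b a≢c b≢c _ _ _ (inj₂ da) (inj₂ db) (inj₂ dc) =
  b≢c (+-cancelˡ-≡ _ _ _ (trans (equidistant⇒sum≡double {w} da db a≢b) (sym (equidistant⇒sum≡double {w} da dc a≢c))))

[m*2+n*2]/2≡m+n : ∀ m n → (m * 2 + n * 2) / 2 ≡ m + n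
[m*2+n*2]/2≡m+n m n = trans (cong (_/ 2) (sym (*-distribʳ-+ 2 m n))) (m*n/n≡m (m + n) 2)

∣m*2-n*2∣/2≡∣m-n∣ : ∀ m n → ∣ m * 2 - n * 2 ∣ / 2 ≡ ∣ m - n ∣
∣m*2-n*2∣/2≡∣m-n∣ m n = trans (cong (_/ 2) (sym (*-distribʳ-∣-∣ 2 m n))) (m*n/n≡m ∣ m - n ∣ 2)

adj⇒oddPrime-halves : ∀ q r → Adj (q * 2) (r * 2) → OddPrime (q + r) × OddPrime ∣ q - r ∣
adj⇒oddPrime-halves q r (_ , sum , dist) =
  subst OddPrime ([m*2+n*2]/2≡m+n q r) sum , subst OddPrime (∣m*2-n*2∣/2≡∣m-n∣ q r) dist

adj-sym : Adj a b → Adj b a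
adj-sym {a} {b} (a≢b , sum , dist) =
  a≢b ∘ sym , subst OddPrime (cong (_/ 2) (+-comm a b)) sum
            , subst OddPrime (cong (_/ 2) (∣-∣-comm a b)) dist

primes∧3∤⇒near3 : ∀ q r → Prime (q + r) → Prime ∣ q - r ∣ → ¬ 3 ∣ q → ¬ 3 ∣ r → Near 3 q r
primes∧3∤⇒near3 q r sum dist 3∤q 3∤r =
  Sum.map (prime∧3∣⇒≡3 sum) (prime∧3∣⇒≡3 dist) (3∤m⇒3∤n⇒3∣m+n⊎3∣∣m-n∣ q r 3∤q 3∤r)

primes∧3∣⇒endpoints : ∀ q r → Prime (q + r) → Prime ∣ q - r ∣ → 3 ∣ q → 3 ∣ r →
  (q ≡ 0 × r ≡ 3) ⊎ (q ≡ 3 × r ≡ 0)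
primes∧3∣⇒endpoints q r sum dist 3∣q 3∣r =
  sum∧dist≡k⇒endpoints (prime∧3∣⇒≡3 sum (∣m∣n⇒∣m+n 3∣q 3∣r)) (prime∧3∣⇒≡3 dist (∣m∣n⇒∣∣m-n∣ 3∣q 3∣r))

adj∧6∤⇒near6 : IsVertex a → IsVertex b → Adj a b → ¬ 6 ∣ a → ¬ 6 ∣ b → Near 6 a b
adj∧6∤⇒near6 (divides q refl) (divides r refl) adj 6∤a 6∤b with adj⇒oddPrime-halves q r adj
... | (sum , _) , (dist , _) = near-*2 q r (primes∧3∤⇒near3 q r sum dist (6∤a ∘ *-monoˡ-∣ 2) (6∤b ∘ *-monoˡ-∣ 2))

adj∧6∣⇒endpoints : IsVertex a → IsVertex b → Adj a b → 6 ∣ a → 6 ∣ b →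
  (a ≡ 0 × b ≡ 6) ⊎ (a ≡ 6 × b ≡ 0)
adj∧6∣⇒endpoints (divides q refl) (divides r refl) adj 6∣a 6∣b with adj⇒oddPrime-halves q r adj
... | (sum , _) , (dist , _) =
  Sum.map (Product.map (cong (_* 2)) (cong (_* 2))) (Product.map (cong (_* 2)) (cong (_* 2)))
          (primes∧3∣⇒endpoints q r sum dist (*-cancelʳ-∣ 2 6∣a) (*-cancelʳ-∣ 2 6∣b))

adj0⇒6≤ : IsVertex y → Adj 0 y → 6 ≤ y
adj0⇒6≤ (divides r refl) adj = *-monoˡ-≤ 2 (oddPrime⇒3≤ (proj₁ (adj⇒oddPrime-halves 0 r adj)))

module _ {A : Set} where

  record ThreeDistinct (xs : List A) : Set where
    constructor threeDistinct
    field
      {u v t}             : A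
      u∈                  : u ∈ xs
      v∈                  : v ∈ xs
      t∈                  : t ∈ xs
      u≢v                 : u ≢ v
      u≢t                 : u ≢ t
      v≢t                 : v ≢ t

  unique⇒threeDistinct : ∀ {xs} → Unique xs → 2 < length xs → ThreeDistinct xs
  unique⇒threeDistinct {_ ∷ _ ∷ _ ∷ _} ((u≢v ∷ u≢t ∷ _) ∷ (v≢t ∷ _) ∷ _) _ =
    threeDistinct (here refl) (there (here refl)) (there (there (here refl))) u≢v u≢t v≢t
  unique⇒threeDistinct {[]}         _ ()
  unique⇒threeDistinct {_ ∷ []}     _ (s≤s ())
  unique⇒threeDistinct {_ ∷ _ ∷ []} _ (s≤s (s≤s ()))

  record TwoDistinctOtherThan (o : A) (xs : List A) : Set where
    constructor twoDistinct
    field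
      {u v}               : A
      u∈                  : u ∈ xs
      v∈                  : v ∈ xs
      u≢v                 : u ≢ v
      u≢o                 : u ≢ o
      v≢o                 : v ≢ o

  threeDistinct⇒twoDistinctOtherThan : DecidableEquality A → ∀ o {xs} →
    ThreeDistinct xs → TwoDistinctOtherThan o xs
  threeDistinct⇒twoDistinctOtherThan _≟_ o (threeDistinct {u} {v} u∈ v∈ t∈ u≢v u≢t v≢t)
    with u ≟ o | v ≟ o
  ... | yes refl | _        = twoDistinct v∈ t∈ v≢t (u≢v ∘ sym) (u≢t ∘ sym)
  ... | no u≢o   | yes refl = twoDistinct u∈ t∈ u≢t u≢o (v≢t ∘ sym)
  ... | no u≢o   | no v≢o   = twoDistinct u∈ v∈ u≢v u≢o v≢o

Vertices : List ℕ → Set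
Vertices xs = ∀ {x} → x ∈ xs → IsVertex x

Inside6ℕ₀ : List ℕ → Set
Inside6ℕ₀ xs = ∀ {x} → x ∈ xs → In6N x

Outside6ℕ₀ : List ℕ → Set
Outside6ℕ₀ xs = ∀ {x} → x ∈ xs → ¬ In6N x

Complete : List ℕ → List ℕ → Set
Complete xs ys = ∀ {x y} → x ∈ xs → y ∈ ys → Adj x y

complete-sym : Complete X Y → Complete Y X
complete-sym adj y∈ x∈ = adj-sym (adj x∈ y∈)

¬three-neighbours-outside6ℕ₀ : IsVertex w → ¬ In6N w → ThreeDistinct Y → Vertices Y →
  Outside6ℕ₀ Y → (∀ {y} → y ∈ Y → Adj w y) → ⊥
¬three-neighbours-outside6ℕ₀ {w} {Y} vw 6∤w (threeDistinct u∈ v∈ t∈ u≢v u≢t v≢t) vY outY adj =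
  ¬three-near u≢v u≢t v≢t (≢0 u∈) (≢0 v∈) (≢0 t∈) (near u∈) (near v∈) (near t∈)
  where
  ≢0 : y ∈ Y → y ≢ 0
  ≢0 y∈ refl = outY y∈ (6 ∣0)
  near : y ∈ Y → Near 6 w y
  near y∈ = adj∧6∤⇒near6 vw (vY y∈) (adj y∈) 6∤w (outY y∈)

opposite-outside⇒inside : ThreeDistinct Y → Vertices X → Vertices Y → Complete X Y →
  Outside6ℕ₀ Y → Inside6ℕ₀ X
opposite-outside⇒inside tY vX vY adj outY {x} x∈ =
  decidable-stable (6 ∣? x) λ 6∤x → ¬three-neighbours-outside6ℕ₀ (vX x∈) 6∤x tY vY outY (adj x∈)

¬0∈∧6∈ : ThreeDistinct X → ThreeDistinct Y → Vertices X → Vertices Y → Complete X Y →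
  0 ∈ X → 6 ∈ Y → ⊥
¬0∈∧6∈ {X} {Y} tX tY vX vY adj 0∈X 6∈Y
  with threeDistinct⇒twoDistinctOtherThan _≟_ 0 tX | threeDistinct⇒twoDistinctOtherThan _≟_ 6 tY
... | twoDistinct x₁∈ x₂∈ x₁≢x₂ x₁≢0 x₂≢0 | twoDistinct y₁∈ y₂∈ y₁≢y₂ y₁≢6 y₂≢6 =
  ¬equidistant-square x₁≢x₂ y₁≢y₂
    (dist x₁∈ x₁≢0 y₁∈ y₁≢6) (dist x₁∈ x₁≢0 y₂∈ y₂≢6) (dist x₂∈ x₂≢0 y₁∈ y₁≢6) (dist x₂∈ x₂≢0 y₂∈ y₂≢6)
  where
  x-outside : x ∈ X → x ≢ 0 → ¬ In6N x
  x-outside x∈ x≢0 6∣x = [ x≢0 ∘ proj₁ , (λ ()) ∘ proj₂ ]′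
    (adj∧6∣⇒endpoints (vX x∈) (vY 6∈Y) (adj x∈ 6∈Y) 6∣x ∣-refl)
  y-outside : y ∈ Y → y ≢ 6 → ¬ In6N y
  y-outside y∈ y≢6 6∣y = [ y≢6 ∘ proj₂ , (λ ()) ∘ proj₁ ]′
    (adj∧6∣⇒endpoints (vX 0∈X) (vY y∈) (adj 0∈X y∈) (6 ∣0) 6∣y)
  6<y : y ∈ Y → y ≢ 6 → 6 < y
  6<y y∈ y≢6 = ≤∧≢⇒< (adj0⇒6≤ (vY y∈) (adj 0∈X y∈)) (y≢6 ∘ sym)
  dist : x ∈ X → x ≢ 0 → y ∈ Y → y ≢ 6 → ∣ x - y ∣ ≡ 6
  dist x∈ x≢0 y∈ y≢6 = k<n∧near⇒dist (6<y y∈ y≢6)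
    (adj∧6∤⇒near6 (vX x∈) (vY y∈) (adj x∈ y∈) (x-outside x∈ x≢0) (y-outside y∈ y≢6))

inside-member⇒opposite-outside : ThreeDistinct X → ThreeDistinct Y → Vertices X → Vertices Y →
  Complete X Y → x ∈ X → In6N x → Outside6ℕ₀ Y
inside-member⇒opposite-outside tX tY vX vY adj x∈ 6∣x y∈ 6∣y
  with adj∧6∣⇒endpoints (vX x∈) (vY y∈) (adj x∈ y∈) 6∣x 6∣y
... | inj₁ (refl , refl) = ¬0∈∧6∈ tX tY vX vY adj x∈ y∈
... | inj₂ (refl , refl) = ¬0∈∧6∈ tY tX vY vX (complete-sym adj) y∈ x∈

one-side-inside6ℕ₀ : ThreeDistinct X → ThreeDistinct Y → Vertices X → Vertices Y → Complete X Y →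
  (Inside6ℕ₀ X × Outside6ℕ₀ Y) ⊎ (Inside6ℕ₀ Y × Outside6ℕ₀ X)
one-side-inside6ℕ₀ {X} tX tY vX vY adj with any? (6 ∣?_) X
... | yes meets =
  let _ , x∈ , 6∣x = find meets
      outY = inside-member⇒opposite-outside tX tY vX vY adj x∈ 6∣x
  in inj₁ (opposite-outside⇒inside tY vX vY adj outY , outY)
... | no misses = inj₂ (opposite-outside⇒inside tX vY vX (complete-sym adj) outX , outX)
  where
  outX : Outside6ℕ₀ X
  outX x∈ 6∣x = misses (lose x∈ 6∣x)

mainTheorem13 : (X Y : List ℕ) → Unique X → Unique Y →
    2 < length X → 2 < length Y →
    (∀ {x} → x ∈ X → IsVertex x) → (∀ {y} → y ∈ Y → IsVertex y) →
    (∀ {x y} → x ∈ X → y ∈ Y → Adj x y) →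
    ((∀ {x} → x ∈ X → In6N x) × (∀ {y} → y ∈ Y → ¬ In6N y))
    ⊎ ((∀ {y} → y ∈ Y → In6N y) × (∀ {x} → x ∈ X → ¬ In6N x))
mainTheorem13 X Y uX uY 2<|X| 2<|Y| vX vY adj =
  one-side-inside6ℕ₀ (unique⇒threeDistinct uX 2<|X|) (unique⇒threeDistinct uY 2<|Y|) vX vY adj
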